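{- Let $m,l$ be positive integers and $h$ a nonnegative integer. Then $\Gamma_{m,l,h}$ is isomorphic to $\mathrm{Cay}\big(\mathbb{Z}_{ml/\tau(h,l)}\times\mathbb{Z}_{\tau(h,l)},\{(\pm l/\tau(h,l),0),\pm(-h/\tau(h,l),1)\}\big)$.
   Context: For $x$ in a residue class ring $\mathbb{Z}_k$, $\hat{x}$ denotes the least nonnegative integer in the class $x$. $\Gamma_{m,l,h}$ is the graph with vertex set $\mathbb{Z}_m\times\mathbb{Z}_l$ whose edges are $\{(a,b),(a+1,b)\}$ for all $a\in\mathbb{Z}_m,b\in\mathbb{Z}_l$; $\{(a,c),(a,c+1)\}$ for all $a\in\mathbb{Z}_m$ and $c\in\mathbb{Z}_l$ with $\hat c\neq l-1$; and $\{(a,-1),(a-h,0)\}$ for all $a\in\mathbb{Z}_m$. For an abelian group $G$ (additive) and inverse-closed $S\subseteq G\setminus\{0\}$, $\mathrm{Cay}(G,S)$ has vertex set $G$ with $x\sim y$ iff $y-x\in S$. For an integer $n$ and nonzero integer $m$, $\tau(n,m)$ is the least positive integer $j$ (dividing $m$) with $\gcd(n,m/j)=1$. -}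

module Defs where

open import Level using (Level; suc; _⊔_)
open import Data.Nat as ℕ using (ℕ; zero; _<_; _≤_; _∸_)
open import Data.Nat.Divisibility using (_∣_; quotient)
open import Data.Nat.GCD using (gcd)
open import Data.Integer as ℤ using (ℤ; +_; -_; _-_)
import Data.Integer.Divisibility as ℤ∣
open import Data.Fin using (Fin; toℕ)
open import Data.Product using (Σ; Σ-syntax; ∃; ∃-syntax; _×_; _,_; proj₁; proj₂)
open import Data.Sum using (_⊎_)
open import Data.List using (List; _∷_; [])
open import Data.List.Membership.Propositional using (_∈_)
open import Function.Bundles using (_↔_; _⇔_; Inverse)
open import Relation.Binary.PropositionalEquality using (_≡_)

record Graph : Set₁ where
  field
    V   : Set
    Adj : V → V → Set

open Graph public

_≅_ : Graph → Graph → Set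
G ≅ H = Σ[ f ∈ (V G ↔ V H) ]
          (∀ u v → Adj G u v ⇔ Adj H (Inverse.to f u) (Inverse.to f v))

Congr : ℕ → ℤ → ℤ → Set
Congr n a b = (+ n) ℤ∣.∣ (a - b)

⟦_⟧ : ∀ {k} → Fin k → ℤ
⟦ c ⟧ = + toℕ c

-- Edges:
--   {(a,b),(a+1,b)}                       for all a, b
--   {(a,c),(a,c+1)}                       for ĉ ≠ l-1
--   {(a,-1),(a-h,0)}                      for all a
-- GammaStep u v says that {u,v} is one of these edges listed as (u,v);
-- adjacency is the symmetric closure.

GammaStep : (m l h : ℕ) → Fin m × Fin l → Fin m × Fin l → Set
GammaStep m l h (a , b) (a' , b') =
    ( Congr m ⟦ a' ⟧ (⟦ a ⟧ ℤ.+ + 1) × b' ≡ b )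
  ⊎ ( a' ≡ a × toℕ b' ≡ ℕ.suc (toℕ b) )
  ⊎ ( toℕ b ≡ l ∸ 1 × toℕ b' ≡ 0 × Congr m ⟦ a' ⟧ (⟦ a ⟧ - + h) )

Γ : (m l h : ℕ) → Graph
Γ m l h = record
  { V   = Fin m × Fin l
  ; Adj = λ u v → GammaStep m l h u v ⊎ GammaStep m l h v u
  }

Cay : (n₁ n₂ : ℕ) → List (ℤ × ℤ) → Graph
Cay n₁ n₂ S = record
  { V   = Fin n₁ × Fin n₂
  ; Adj = λ { (x₁ , x₂) (y₁ , y₂) →
              ∃[ s ] ( s ∈ S
                     × Congr n₁ (⟦ y₁ ⟧ - ⟦ x₁ ⟧) (proj₁ s)
                     × Congr n₂ (⟦ y₂ ⟧ - ⟦ x₂ ⟧) (proj₂ s) ) }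
  }

IsTau : (n m j : ℕ) → j ∣ m → Set
IsTau n m j d =
    0 < j
  × gcd n (quotient d) ≡ 1
  × (∀ k → (e : k ∣ m) → 0 < k → gcd n (quotient e) ≡ 1 → j ≤ k)

-- The map (a, b) ↦ (q·â + c·b̂ mod ml/τ, b̂ mod τ), where q = l/τ and τc ≡ −h, sends each edge
-- (a, b) → (a + 1, b) to the generator (q, 0) and each edge (a, b) → (a, b + 1) to (c, 1); so does
-- the wrap-around edge (a, l − 1) → (a − h, 0), because c·l = q·τc ≡ −qh.  The map is injective:
-- equal images give b̂ − b̂′ = tτ and then q(â − â′) ≡ ht (mod ml/τ), so q ∣ ht, hence q ∣ t as
-- gcd(h, q) = 1, i.e. l ∣ b̂ − b̂′.  Both vertex sets have ml elements, so it is a bijection, and it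
-- reflects adjacency because every vertex has exactly one outgoing edge along each generator.
module Submission where

open import Defs

module Construction where

  open import Level using (0ℓ)
  open import Data.Nat as ℕ using (ℕ; zero; suc; NonZero; _∸_)
  import Data.Nat.Properties as ℕ
  import Data.Nat.Divisibility as ℕ
  open import Data.Nat.Coprimality using (Coprime)
  open import Data.Integer as ℤ using (ℤ; +_; -_; _+_; _-_; _*_; ∣_∣)
  import Data.Integer.Properties as ℤ
  import Data.Integer.DivMod as ℤ
  import Data.Integer.Coprimality as ℤ
  open import Data.Integer.Divisibility.Signed as ℤˢ using (divides)
  open import Data.Integer.Tactic.RingSolver using (solve; solve-∀)
  open import Data.Fin as Fin using (Fin; toℕ; fromℕ<)
  import Data.Fin.Properties as Fin
  open import Data.List using (List; _∷_; [])
  open import Data.List.Membership.Propositional using (_∈_)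
  open import Data.List.Relation.Unary.Any using (here; there)
  open import Data.Product using (Σ; ∃-syntax; _×_; _,_; proj₁; proj₂)
  open import Data.Sum using (_⊎_; inj₁; inj₂)
  open import Function using (_∘_; Injective; StrictlySurjective; _↔_; Inverse; _↣_; Injection)
  open import Function using (_⤖_; mk⤖; mk↣; _⇔_; mk⇔; Equivalence)
  open import Function.Construct.Composition using (_↣-∘_)
  open import Function.Consequences.Propositional using (strictlySurjective⇒surjective)
  open import Function.Properties.Bijection using (⤖⇒↔)
  open import Function.Properties.Inverse using (↔-sym; ↔⇒↣)
  open import Relation.Binary.Bundles using (Setoid)
  open import Relation.Binary.Structures using (IsEquivalence)
  open import Relation.Nullary using (yes; no; contradiction)
  open import Relation.Binary.PropositionalEquality

  private
    variable
      m n p : ℕ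
      x y z x′ y′ : ℤ

  -- A record rather than Congr: Congr n x y only mentions ∣ x - y ∣, from which Agda cannot
  -- infer x and y.
  infix 4 _≡_mod_
  record _≡_mod_ (x y : ℤ) (n : ℕ) : Set where
    constructor mod-divides
    field divides-difference : + n ℤˢ.∣ x - y

  open _≡_mod_

  Congr⇒≡mod : Congr n x y → x ≡ y mod n
  Congr⇒≡mod c = mod-divides (ℤˢ.∣ᵤ⇒∣ c)

  ≡mod⇒Congr : x ≡ y mod n → Congr n x y
  ≡mod⇒Congr c = ℤˢ.∣⇒∣ᵤ (divides-difference c)

  ∣-difference⇒≡mod : ∀ {d} → + n ℤˢ.∣ d → x - y ≡ d → x ≡ y mod n
  ∣-difference⇒≡mod n∣d eq = mod-divides (subst (_ ℤˢ.∣_) (sym eq) n∣d)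

  ≡⇒≡mod : x ≡ y → x ≡ y mod n
  ≡⇒≡mod {x = x} refl = ∣-difference⇒≡mod (divides (+ 0) refl) (ℤ.+-inverseʳ x)

  ≡mod-refl : x ≡ x mod n
  ≡mod-refl = ≡⇒≡mod refl

  ≡mod-sym : x ≡ y mod n → y ≡ x mod n
  ≡mod-sym {x = x} {y = y} (mod-divides d) =
    ∣-difference⇒≡mod (ℤˢ.∣m⇒∣-m d) (solve (x ∷ y ∷ []))

  ≡mod-trans : x ≡ y mod n → y ≡ z mod n → x ≡ z mod n
  ≡mod-trans {x = x} {y = y} {z = z} (mod-divides d) (mod-divides d′) =
    ∣-difference⇒≡mod (ℤˢ.∣m∣n⇒∣m+n d d′) (solve (x ∷ y ∷ z ∷ []))

  ≡mod-isEquivalence : IsEquivalence (λ x y → x ≡ y mod n)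
  ≡mod-isEquivalence = record { refl = ≡mod-refl ; sym = ≡mod-sym ; trans = ≡mod-trans }

  ℤ-mod : ℕ → Setoid 0ℓ 0ℓ
  ℤ-mod n = record { isEquivalence = ≡mod-isEquivalence {n} }

  module ≡mod-Reasoning (n : ℕ) where
    open import Relation.Binary.Reasoning.Setoid (ℤ-mod n) public

  ≡mod-+ : x ≡ y mod n → x′ ≡ y′ mod n → x + x′ ≡ y + y′ mod n
  ≡mod-+ {x = x} {y = y} {x′ = x′} {y′ = y′} (mod-divides d) (mod-divides d′) =
    ∣-difference⇒≡mod (ℤˢ.∣m∣n⇒∣m+n d d′) (solve (x ∷ y ∷ x′ ∷ y′ ∷ []))

  ≡mod-neg : x ≡ y mod n → - x ≡ - y mod n
  ≡mod-neg {x = x} {y = y} (mod-divides d) =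
    ∣-difference⇒≡mod (ℤˢ.∣m⇒∣-m d) (solve (x ∷ y ∷ []))

  ≡mod-- : x ≡ y mod n → x′ ≡ y′ mod n → x - x′ ≡ y - y′ mod n
  ≡mod-- c c′ = ≡mod-+ c (≡mod-neg c′)

  ≡mod-*ˡ : ∀ k → x ≡ y mod n → k * x ≡ k * y mod n
  ≡mod-*ˡ {x = x} {y = y} k (mod-divides d) =
    ∣-difference⇒≡mod (ℤˢ.∣n⇒∣m*n k d) (solve (k ∷ x ∷ y ∷ []))

  ≡mod-multiple : ∀ k → k * + n ≡ + 0 mod n
  ≡mod-multiple k = ∣-difference⇒≡mod (ℤˢ.∣n⇒∣m*n k ℤˢ.∣-refl) (ℤ.+-identityʳ _)

  ≡mod-0⇒∣ : x ≡ + 0 mod n → + n ℤˢ.∣ x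
  ≡mod-0⇒∣ {x = x} (mod-divides d) = subst (_ ℤˢ.∣_) (ℤ.+-identityʳ x) d

  ≡mod-∣ : p ℕ.∣ n → x ≡ y mod n → x ≡ y mod p
  ≡mod-∣ p∣n (mod-divides d) = mod-divides (ℤˢ.∣-trans (ℤˢ.∣ᵤ⇒∣ p∣n) d)

  +[m*n]≡+n*+m : ∀ m n → + (m ℕ.* n) ≡ + n * + m
  +[m*n]≡+n*+m m n = trans (ℤ.pos-* m n) (ℤ.*-comm (+ m) (+ n))

  *-distribˡ-- : ∀ k x y → k * (x - y) ≡ k * x - k * y
  *-distribˡ-- = solve-∀

  ≡mod-scale : ∀ q → x ≡ y mod m → + q * x ≡ + q * y mod (m ℕ.* q)
  ≡mod-scale {x = x} {y = y} {m = m} q (mod-divides d) = mod-divides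
    (subst₂ ℤˢ._∣_ (sym (+[m*n]≡+n*+m m q)) (*-distribˡ-- (+ q) x y) (ℤˢ.*-monoʳ-∣ (+ q) d))

  ≡mod-unscale : ∀ q .{{_ : NonZero q}} → + q * x ≡ + q * y mod (m ℕ.* q) → x ≡ y mod m
  ≡mod-unscale {x = x} {y = y} {m = m} q (mod-divides d) = mod-divides (ℤˢ.*-cancelˡ-∣ (+ q)
    (subst₂ ℤˢ._∣_ (+[m*n]≡+n*+m m q) (sym (*-distribˡ-- (+ q) x y)) d))

  ≡mod-neg-difference : y - x ≡ z mod n → x - y ≡ - z mod n
  ≡mod-neg-difference {y = y} {x = x} {z = z} {n = n} c = begin
    x - y     ≡⟨ solve (x ∷ y ∷ []) ⟩
    - (y - x) ≈⟨ ≡mod-neg c ⟩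
    - z       ∎
    where open ≡mod-Reasoning n

  ≡mod-difference-cancel : y - x ≡ z mod n → y′ - x ≡ z mod n → y ≡ y′ mod n
  ≡mod-difference-cancel {y = y} {x = x} {n = n} {y′ = y′} c c′ = begin
    y            ≡⟨ solve (x ∷ y ∷ []) ⟩
    (y - x) + x  ≈⟨ ≡mod-+ (≡mod-trans c (≡mod-sym c′)) ≡mod-refl ⟩
    (y′ - x) + x ≡⟨ solve (x ∷ y′ ∷ []) ⟩
    y′           ∎
    where open ≡mod-Reasoning n

  [1+x]-x≡1 : y ≡ + 1 + x → y - x ≡ + 1
  [1+x]-x≡1 {x = x} refl = solve (x ∷ [])

  ≡mod-wrap : ∀ k → y + + 1 ≡ k * + n → + 0 - y ≡ + 1 mod n
  ≡mod-wrap {y = y} {n = n} k y+1≡kn = begin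
    + 0 - y         ≡⟨ solve (y ∷ []) ⟩
    + 1 - (y + + 1) ≡⟨ cong (λ x → + 1 - x) y+1≡kn ⟩
    + 1 - k * + n   ≈⟨ ≡mod-- (≡mod-refl {x = + 1}) (≡mod-multiple k) ⟩
    + 1             ∎
    where open ≡mod-Reasoning n

  n∣m<n⇒m≡0 : n ℕ.∣ m → m ℕ.< n → m ≡ 0
  n∣m<n⇒m≡0 {m = zero}  _   _   = refl
  n∣m<n⇒m≡0 {m = suc _} n∣m m<n = contradiction n∣m (ℕ.>⇒∤ m<n)

  ≡mod∧≤⇒≥ : {i j : Fin n} → ⟦ i ⟧ ≡ ⟦ j ⟧ mod n → toℕ i ℕ.≤ toℕ j → toℕ j ℕ.≤ toℕ i
  ≡mod∧≤⇒≥ {n = n} {i} {j} c i≤j = ℕ.m∸n≡0⇒m≤n (n∣m<n⇒m≡0 n∣j∸i j∸i<n)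
    where
    n∣j∸i : n ℕ.∣ toℕ j ∸ toℕ i
    n∣j∸i = subst (n ℕ.∣_)
      (trans (cong ∣_∣ (ℤ.m-n≡m⊖n (toℕ i) (toℕ j))) (ℤ.∣⊖∣-≤ i≤j)) (≡mod⇒Congr c)
    j∸i<n : toℕ j ∸ toℕ i ℕ.< n
    j∸i<n = ℕ.≤-<-trans (ℕ.m∸n≤m (toℕ j) (toℕ i)) (Fin.toℕ<n j)

  ≡mod⇒≡ : {i j : Fin n} → ⟦ i ⟧ ≡ ⟦ j ⟧ mod n → i ≡ j
  ≡mod⇒≡ {i = i} {j} c with ℕ.≤-total (toℕ i) (toℕ j)
  ... | inj₁ i≤j = Fin.toℕ-injective (ℕ.≤-antisym i≤j (≡mod∧≤⇒≥ c i≤j))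
  ... | inj₂ j≤i = Fin.toℕ-injective (ℕ.≤-antisym (≡mod∧≤⇒≥ (≡mod-sym c) j≤i) j≤i)

  reduce : ∀ n .{{_ : NonZero n}} → ℤ → Fin n
  reduce n x = fromℕ< (ℤ.n%ℕd<d x n)

  reduce-≡mod : ∀ n .{{_ : NonZero n}} x → ⟦ reduce n x ⟧ ≡ x mod n
  reduce-≡mod n x = ∣-difference⇒≡mod (ℤˢ.∣m⇒∣-m (ℤˢ.∣n⇒∣m*n (x ℤ./ℕ n) ℤˢ.∣-refl)) (begin
    ⟦ reduce n x ⟧ - x
      ≡⟨ cong₂ _-_ (cong +_ (Fin.toℕ-fromℕ< _)) (ℤ.a≡a%ℕn+[a/ℕn]*n x n) ⟩
    + (x ℤ.%ℕ n) - (+ (x ℤ.%ℕ n) + (x ℤ./ℕ n) * + n)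
      ≡⟨ x-[x+y]≡-y (+ (x ℤ.%ℕ n)) _ ⟩
    - ((x ℤ./ℕ n) * + n) ∎)
    where
    open ≡-Reasoning
    x-[x+y]≡-y : ∀ x y → x - (x + y) ≡ - y
    x-[x+y]≡-y = solve-∀

  reduce-≡⇒≡mod : ∀ n .{{_ : NonZero n}} {x y} → reduce n x ≡ reduce n y → x ≡ y mod n
  reduce-≡⇒≡mod n {x} {y} eq = ≡mod-trans (≡mod-sym (reduce-≡mod n x))
    (subst (λ r → ⟦ r ⟧ ≡ y mod n) (sym eq) (reduce-≡mod n y))

  reduce-difference : ∀ n .{{_ : NonZero n}} x y →
                      Congr n (⟦ reduce n y ⟧ - ⟦ reduce n x ⟧) z ⇔ y - x ≡ z mod n
  reduce-difference n x y = mk⇔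
    (λ c → ≡mod-trans (≡mod-sym reduced) (Congr⇒≡mod c))
    (λ c → ≡mod⇒Congr (≡mod-trans reduced c))
    where
    reduced : ⟦ reduce n y ⟧ - ⟦ reduce n x ⟧ ≡ y - x mod n
    reduced = ≡mod-- (reduce-≡mod n y) (reduce-≡mod n x)

  injective⇒strictlySurjective : {f : Fin n → Fin n} → Injective _≡_ _≡_ f →
                                 StrictlySurjective _≡_ f
  injective⇒strictlySurjective {suc n} {f} f-inj y with Fin.any? (λ x → f x Fin.≟ y)
  ... | yes hit = hit
  ... | no miss = contradiction (Fin.injective⇒≤ avoid-y-injective) ℕ.1+n≰n
    where
    y≢f : ∀ x → y ≢ f x
    y≢f x y≡fx = miss (x , sym y≡fx)
    avoid-y-injective : Injective _≡_ _≡_ (λ x → Fin.punchOut (y≢f x))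
    avoid-y-injective eq = f-inj (Fin.punchOut-injective (y≢f _) (y≢f _) eq)

  finite-↣⇒⤖ : ∀ {A B : Set} → A ↔ Fin n → B ↔ Fin n → A ↣ B → A ⤖ B
  finite-↣⇒⤖ A↔Fin B↔Fin f = mk⤖ (F.injective , strictlySurjective⇒surjective surjective)
    where
    module F = Injection f
    g : Fin _ ↣ Fin _
    g = ↔⇒↣ B↔Fin ↣-∘ (f ↣-∘ ↔⇒↣ (↔-sym A↔Fin))
    surjective : StrictlySurjective _≡_ F.to
    surjective y
      with x , gx≡y ← injective⇒strictlySurjective (Injection.injective g) (Inverse.to B↔Fin y)
      = Inverse.from A↔Fin x , Injection.injective (↔⇒↣ B↔Fin) gx≡y

  module LinearForm (Q C : ℤ) where

    ψ : ℤ → ℤ → ℤ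
    ψ A B = Q * A + C * B

    ψ-stepˡ : ∀ {A A′ B} → Q * A′ ≡ Q * (A + + 1) mod n → ψ A′ B - ψ A B ≡ Q mod n
    ψ-stepˡ {n = n} {A} {A′} {B} QA′≡ = begin
      (Q * A′ + C * B) - (Q * A + C * B) ≡⟨ solve (Q ∷ C ∷ A ∷ A′ ∷ B ∷ []) ⟩
      Q * A′ - Q * A                     ≈⟨ ≡mod-- QA′≡ ≡mod-refl ⟩
      Q * (A + + 1) - Q * A              ≡⟨ solve (Q ∷ A ∷ []) ⟩
      Q                                  ∎
      where open ≡mod-Reasoning n

    ψ-stepʳ : ∀ {A B B′} → B′ ≡ + 1 + B → ψ A B′ - ψ A B ≡ C
    ψ-stepʳ {A} {B} refl = begin
      (Q * A + C * (+ 1 + B)) - (Q * A + C * B) ≡⟨ solve (Q ∷ C ∷ A ∷ B ∷ []) ⟩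
      C                                         ∎
      where open ≡-Reasoning

    ψ-wrap : ∀ {A A′ B B′ H T} → T * C ≡ - H mod n → B + + 1 ≡ Q * T → B′ ≡ + 0 →
             Q * A′ ≡ Q * (A - H) mod n → ψ A′ B′ - ψ A B ≡ C mod n
    ψ-wrap {n = n} {A} {A′} {B} {H = H} {T} TC≡-H B+1≡QT refl QA′≡ = begin
      (Q * A′ + C * + 0) - (Q * A + C * B) ≡⟨ solve (Q ∷ C ∷ A ∷ A′ ∷ B ∷ []) ⟩
      Q * A′ - Q * A - C * (B + + 1) + C   ≡⟨ cong (λ x → Q * A′ - Q * A - C * x + C) B+1≡QT ⟩
      Q * A′ - Q * A - C * (Q * T) + C     ≡⟨ solve (Q ∷ C ∷ A ∷ A′ ∷ T ∷ []) ⟩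
      Q * A′ - Q * A - Q * (T * C) + C
        ≈⟨ ≡mod-+ (≡mod-- (≡mod-- QA′≡ ≡mod-refl) (≡mod-*ˡ Q TC≡-H)) ≡mod-refl ⟩
      Q * (A - H) - Q * A - Q * (- H) + C  ≡⟨ solve (Q ∷ C ∷ A ∷ H ∷ []) ⟩
      C                                    ∎
      where open ≡mod-Reasoning n

    ψ-cancelʳ : ∀ {A A′ B} → ψ A B ≡ ψ A′ B mod n → Q * A ≡ Q * A′ mod n
    ψ-cancelʳ {n = n} {A} {A′} {B} ψ≡ = begin
      Q * A                    ≡⟨ solve (Q ∷ C ∷ A ∷ B ∷ []) ⟩
      (Q * A + C * B) - C * B  ≈⟨ ≡mod-- ψ≡ ≡mod-refl ⟩
      (Q * A′ + C * B) - C * B ≡⟨ solve (Q ∷ C ∷ A′ ∷ B ∷ []) ⟩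
      Q * A′                   ∎
      where open ≡mod-Reasoning n

    ψ-difference : ∀ {A A′ B B′ H T t} → T * C ≡ - H mod n →
                   ψ A B ≡ ψ A′ B′ mod n → B - B′ ≡ t * T → Q * (A - A′) ≡ H * t mod n
    ψ-difference {n = n} {A} {A′} {B} {B′} {H} {T} {t} TC≡-H ψ≡ ΔB≡tT = begin
      Q * (A - A′)
        ≡⟨ solve (Q ∷ C ∷ A ∷ A′ ∷ B ∷ B′ ∷ []) ⟩
      ((Q * A + C * B) - (Q * A′ + C * B′)) - C * (B - B′)
        ≈⟨ ≡mod-- (≡mod-- ψ≡ ≡mod-refl) ≡mod-refl ⟩
      (ψ A′ B′ - ψ A′ B′) - C * (B - B′)
        ≡⟨ cong (λ x → (ψ A′ B′ - ψ A′ B′) - C * x) ΔB≡tT ⟩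
      ((Q * A′ + C * B′) - (Q * A′ + C * B′)) - C * (t * T)
        ≡⟨ solve (Q ∷ C ∷ A′ ∷ B′ ∷ T ∷ t ∷ []) ⟩
      - t * (T * C)
        ≈⟨ ≡mod-*ˡ (- t) TC≡-H ⟩
      - t * - H
        ≡⟨ solve (H ∷ t ∷ []) ⟩
      H * t ∎
      where open ≡mod-Reasoning n

  module Γ≅Cayley (m l h τ q : ℕ) {{_ : NonZero m}} {{_ : NonZero τ}} {{_ : NonZero q}}
    (l≡q*τ : l ≡ q ℕ.* τ) (q⊥h : Coprime q h)
    (c : ℤ) (τc≡-h : + τ * c ≡ - + h mod (m ℕ.* q)) where

    open LinearForm (+ q) c

    N : ℕ
    N = m ℕ.* q

    instance
      N-nonZero : NonZero N
      N-nonZero = ℕ.m*n≢0 m q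

    a-generator b-generator : ℤ × ℤ
    a-generator = + q , + 0
    b-generator = c , + 1

    S : List (ℤ × ℤ)
    S = a-generator ∷ (- + q , + 0) ∷ b-generator ∷ (- c , - + 1) ∷ []

    Vertex : Set
    Vertex = Fin m × Fin l

    ψ₁ ψ₂ : Vertex → ℤ
    ψ₁ (a , b) = ψ ⟦ a ⟧ ⟦ b ⟧
    ψ₂ (a , b) = ⟦ b ⟧

    φ : Vertex → Fin N × Fin τ
    φ u = reduce N (ψ₁ u) , reduce τ (ψ₂ u)

    Shift : Vertex → Vertex → ℤ × ℤ → Set
    Shift u v s = ψ₁ v - ψ₁ u ≡ proj₁ s mod N × ψ₂ v - ψ₂ u ≡ proj₂ s mod τ

    GeneratorShift : Vertex → Vertex → Set
    GeneratorShift u v = ∃[ s ] (s ∈ S × Shift u v s)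

    +l≡+q*+τ : + l ≡ + q * + τ
    +l≡+q*+τ = trans (cong +_ l≡q*τ) (ℤ.pos-* q τ)

    Δb≡tτ⇒q∣t : ∀ {u v t} → ψ₁ u ≡ ψ₁ v mod N → ψ₂ u - ψ₂ v ≡ t * + τ → + q ℤˢ.∣ t
    Δb≡tτ⇒q∣t {a , _} {a′ , _} {t} ψ₁≡ Δb≡tτ =
      ℤˢ.∣ᵤ⇒∣ (ℤ.coprime-divisor (+ q) (+ h) t q⊥h (ℤˢ.∣⇒∣ᵤ (≡mod-0⇒∣ ht≡0)))
      where
      ht≡0 : + h * t ≡ + 0 mod q
      ht≡0 = begin
        + h * t                ≈⟨ ≡mod-∣ (ℕ.n∣m*n m) (ψ-difference τc≡-h ψ₁≡ Δb≡tτ) ⟨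
        + q * (⟦ a ⟧ - ⟦ a′ ⟧) ≡⟨ ℤ.*-comm (+ q) _ ⟩
        (⟦ a ⟧ - ⟦ a′ ⟧) * + q ≈⟨ ≡mod-multiple (⟦ a ⟧ - ⟦ a′ ⟧) ⟩
        + 0                    ∎
        where open ≡mod-Reasoning q

    ψ₂-≡mod-l : ∀ {u v} → ψ₁ u ≡ ψ₁ v mod N → ψ₂ u ≡ ψ₂ v mod τ → ψ₂ u ≡ ψ₂ v mod l
    ψ₂-≡mod-l {u} {v} ψ₁≡ (mod-divides (divides t Δb≡tτ)) =
      ∣-difference⇒≡mod (ℤˢ.∣n⇒∣m*n s ℤˢ.∣-refl) (begin
        ψ₂ u - ψ₂ v     ≡⟨ Δb≡tτ ⟩
        t * + τ         ≡⟨ cong (_* + τ) t≡sq ⟩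
        s * + q * + τ   ≡⟨ ℤ.*-assoc s (+ q) (+ τ) ⟩
        s * (+ q * + τ) ≡⟨ cong (s *_) +l≡+q*+τ ⟨
        s * + l         ∎)
      where
      open ≡-Reasoning
      open ℤˢ._∣_ (Δb≡tτ⇒q∣t {u} {v} {t} ψ₁≡ Δb≡tτ) renaming (quotient to s; equality to t≡sq)

    ψ-injective-mod : ∀ {u v} → ψ₁ u ≡ ψ₁ v mod N → ψ₂ u ≡ ψ₂ v mod τ → u ≡ v
    ψ-injective-mod {a , b} {a′ , b′} ψ₁≡ ψ₂≡ = cong₂ _,_ a≡a′ b≡b′
      where
      b≡b′ : b ≡ b′
      b≡b′ = ≡mod⇒≡ (ψ₂-≡mod-l {a , b} {a′ , b′} ψ₁≡ ψ₂≡)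
      ψ₁≡′ : ψ ⟦ a ⟧ ⟦ b ⟧ ≡ ψ ⟦ a′ ⟧ ⟦ b ⟧ mod N
      ψ₁≡′ = subst (λ x → ψ ⟦ a ⟧ ⟦ b ⟧ ≡ ψ ⟦ a′ ⟧ ⟦ x ⟧ mod N) (sym b≡b′) ψ₁≡
      a≡a′ : a ≡ a′
      a≡a′ = ≡mod⇒≡ (≡mod-unscale {m = m} q (ψ-cancelʳ {A = ⟦ a ⟧} {⟦ a′ ⟧} {⟦ b ⟧} ψ₁≡′))

    φ-injective : Injective _≡_ _≡_ φ
    φ-injective φu≡φv = ψ-injective-mod
      (reduce-≡⇒≡mod N (cong proj₁ φu≡φv)) (reduce-≡⇒≡mod τ (cong proj₂ φu≡φv))

    φ-⤖ : Vertex ⤖ (Fin N × Fin τ)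
    φ-⤖ = finite-↣⇒⤖ (↔-sym (Fin.*↔× {m} {l}))
      (subst (λ k → (Fin N × Fin τ) ↔ Fin k) N*τ≡m*l (↔-sym (Fin.*↔× {N} {τ})))
      (mk↣ φ-injective)
      where
      N*τ≡m*l : N ℕ.* τ ≡ m ℕ.* l
      N*τ≡m*l = trans (ℕ.*-assoc m q τ) (cong (m ℕ.*_) (sym l≡q*τ))

    a-step-shift : ∀ {a a′ b} → ⟦ a′ ⟧ ≡ ⟦ a ⟧ + + 1 mod m → Shift (a , b) (a′ , b) a-generator
    a-step-shift {b = b} a′≡a+1 = ψ-stepˡ (≡mod-scale q a′≡a+1) , ≡⇒≡mod (ℤ.+-inverseʳ ⟦ b ⟧)

    b-step-shift : ∀ {a b b′} → toℕ b′ ≡ suc (toℕ b) → Shift (a , b) (a , b′) b-generator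
    b-step-shift {b = b} b′≡b+1 =
      ≡⇒≡mod (ψ-stepʳ (cong +_ b′≡b+1)) , ≡⇒≡mod ([1+x]-x≡1 {x = ⟦ b ⟧} (cong +_ b′≡b+1))

    last-index : ∀ {b : Fin l} → toℕ b ≡ l ∸ 1 → ⟦ b ⟧ + + 1 ≡ + q * + τ
    last-index {b} b≡l-1 = begin
      + (toℕ b ℕ.+ 1) ≡⟨ cong (λ k → + (k ℕ.+ 1)) b≡l-1 ⟩
      + (l ∸ 1 ℕ.+ 1) ≡⟨ cong +_ (ℕ.m∸n+n≡m (ℕ.≤-trans (ℕ.s≤s ℕ.z≤n) (Fin.toℕ<n b))) ⟩
      + l             ≡⟨ +l≡+q*+τ ⟩
      + q * + τ       ∎
      where open ≡-Reasoning

    wrap-step-shift : ∀ {a a′ b b′} → toℕ b ≡ l ∸ 1 → toℕ b′ ≡ 0 →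
                      ⟦ a′ ⟧ ≡ ⟦ a ⟧ - + h mod m → Shift (a , b) (a′ , b′) b-generator
    wrap-step-shift {b = b} b≡l-1 b′≡0 a′≡a-h =
        ψ-wrap τc≡-h (last-index b≡l-1) (cong +_ b′≡0) (≡mod-scale q a′≡a-h)
      , subst (λ B′ → B′ - ⟦ b ⟧ ≡ + 1 mod τ) (cong +_ (sym b′≡0))
          (≡mod-wrap {y = ⟦ b ⟧} (+ q) (last-index b≡l-1))

    step-shift : ∀ {u v} → GammaStep m l h u v → Shift u v a-generator ⊎ Shift u v b-generator
    step-shift (inj₁ (a′≡a+1 , refl))        = inj₁ (a-step-shift (Congr⇒≡mod a′≡a+1))
    step-shift (inj₂ (inj₁ (refl , b′≡b+1))) = inj₂ (b-step-shift b′≡b+1)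
    step-shift (inj₂ (inj₂ (b≡l-1 , b′≡0 , a′≡a-h))) =
      inj₂ (wrap-step-shift b≡l-1 b′≡0 (Congr⇒≡mod a′≡a-h))

    Successors : ℤ × ℤ → Set
    Successors s = ∀ u → ∃[ v ] (GammaStep m l h u v × Shift u v s)

    a-successor : Successors a-generator
    a-successor (a , b) = (a′ , b) , inj₁ (≡mod⇒Congr a′≡a+1 , refl) , a-step-shift a′≡a+1
      where
      a′ = reduce m (⟦ a ⟧ + + 1)
      a′≡a+1 = reduce-≡mod m (⟦ a ⟧ + + 1)

    b-successor : Successors b-generator
    b-successor (a , b) with suc (toℕ b) ℕ.<? l
    ... | yes b+1<l = (a , fromℕ< b+1<l) , inj₂ (inj₁ (refl , Fin.toℕ-fromℕ< b+1<l))
                    , b-step-shift (Fin.toℕ-fromℕ< b+1<l)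
    ... | no b+1≮l  = (a′ , fromℕ< 0<l)
                    , inj₂ (inj₂ (b≡l-1 , Fin.toℕ-fromℕ< 0<l , ≡mod⇒Congr a′≡a-h))
                    , wrap-step-shift b≡l-1 (Fin.toℕ-fromℕ< 0<l) a′≡a-h
      where
      0<l : 0 ℕ.< l
      0<l = ℕ.≤-trans (ℕ.s≤s ℕ.z≤n) (Fin.toℕ<n b)
      b≡l-1 : toℕ b ≡ l ∸ 1
      b≡l-1 = cong (_∸ 1) (ℕ.≤-antisym (Fin.toℕ<n b) (ℕ.≮⇒≥ b+1≮l))
      a′ = reduce m (⟦ a ⟧ - + h)
      a′≡a-h = reduce-≡mod m (⟦ a ⟧ - + h)

    shift-determined : ∀ {u v w s} → Shift u v s → Shift u w s → v ≡ w
    shift-determined {u} (ψ₁v , ψ₂v) (ψ₁w , ψ₂w) = ψ-injective-mod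
      (≡mod-difference-cancel {x = ψ₁ u} ψ₁v ψ₁w) (≡mod-difference-cancel {x = ψ₂ u} ψ₂v ψ₂w)

    successor-step : ∀ {s u v} → Successors s → Shift u v s → GammaStep m l h u v
    successor-step {u = u} successors u→v =
      subst (GammaStep m l h u) (shift-determined u→w-shift u→v) u→w
      where open Σ (proj₂ (successors u)) renaming (proj₁ to u→w; proj₂ to u→w-shift)

    shift-neg : ∀ {u v s} → Shift u v s → Shift v u (- proj₁ s , - proj₂ s)
    shift-neg {u} {v} (ψ₁≡ , ψ₂≡) =
      ≡mod-neg-difference {y = ψ₁ v} {x = ψ₁ u} ψ₁≡ , ≡mod-neg-difference {y = ψ₂ v} {x = ψ₂ u} ψ₂≡

    shift-neg⁻¹ : ∀ {u v} s → Shift u v (- proj₁ s , - proj₂ s) → Shift v u s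
    shift-neg⁻¹ {u} {v} (s₁ , s₂) shift with ψ₁≡ , ψ₂≡ ← shift-neg {u} {v} shift =
        subst (λ x → ψ₁ u - ψ₁ v ≡ x mod N) (ℤ.neg-involutive s₁) ψ₁≡
      , subst (λ x → ψ₂ u - ψ₂ v ≡ x mod τ) (ℤ.neg-involutive s₂) ψ₂≡

    Γ⇒GeneratorShift : ∀ {u v} → Adj (Γ m l h) u v → GeneratorShift u v
    Γ⇒GeneratorShift (inj₁ u→v) with step-shift u→v
    ... | inj₁ shift = _ , here refl , shift
    ... | inj₂ shift = _ , there (there (here refl)) , shift
    Γ⇒GeneratorShift (inj₂ v→u) with step-shift v→u
    ... | inj₁ shift = _ , there (here refl) , shift-neg shift
    ... | inj₂ shift = _ , there (there (there (here refl))) , shift-neg shift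

    GeneratorShift⇒Γ : ∀ {u v} → GeneratorShift u v → Adj (Γ m l h) u v
    GeneratorShift⇒Γ (_ , here refl , shift) = inj₁ (successor-step a-successor shift)
    GeneratorShift⇒Γ (_ , there (here refl) , shift) =
      inj₂ (successor-step a-successor (shift-neg⁻¹ a-generator shift))
    GeneratorShift⇒Γ (_ , there (there (here refl)) , shift) =
      inj₁ (successor-step b-successor shift)
    GeneratorShift⇒Γ (_ , there (there (there (here refl))) , shift) =
      inj₂ (successor-step b-successor (shift-neg⁻¹ b-generator shift))

    Cay⇔GeneratorShift : ∀ u v → Adj (Cay N τ S) (φ u) (φ v) ⇔ GeneratorShift u v
    Cay⇔GeneratorShift u v = mk⇔
      (λ (s , s∈S , c₁ , c₂) → s , s∈S , to (reduce-difference N (ψ₁ u) (ψ₁ v)) c₁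
                                       , to (reduce-difference τ (ψ₂ u) (ψ₂ v)) c₂)
      (λ (s , s∈S , c₁ , c₂) → s , s∈S , from (reduce-difference N (ψ₁ u) (ψ₁ v)) c₁
                                       , from (reduce-difference τ (ψ₂ u) (ψ₂ v)) c₂)
      where open Equivalence

    Γ≅Cay : Γ m l h ≅ Cay N τ S
    Γ≅Cay = ⤖⇒↔ φ-⤖ , λ u v → mk⇔
      (from (Cay⇔GeneratorShift u v) ∘ Γ⇒GeneratorShift)
      (GeneratorShift⇒Γ ∘ to (Cay⇔GeneratorShift u v))
      where open Equivalence

open import Data.Nat using (ℕ; _<_; _*_)
open import Data.Nat.Base using (>-nonZero)
open import Data.Nat.Divisibility using (_∣_; quotient; quotient≢0; module _∣_)
open import Data.Nat.Coprimality using (gcd≡1⇒coprime; sym)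
open import Data.Integer using (+_; -_)
open import Data.Fin using (Fin)
open import Data.Product using (_,_)
open import Data.List using (_∷_; [])
open Construction using (module Γ≅Cayley; Congr⇒≡mod)

proposition2p2 : (m l h : ℕ) → 0 < m → 0 < l →
    (τ : ℕ) (d : τ ∣ l) → IsTau h l τ d →
    -- c ∈ ℤ_{ml/τ} is "-h/τ":  τ·c ≡ -h (mod ml/τ)
    (c : Fin (m * quotient d)) →
    Congr (m * quotient d) ((+ τ) Data.Integer.* ⟦ c ⟧) (- (+ h)) →
    Γ m l h ≅ Cay (m * quotient d) τ
      ( (+ quotient d , + 0) ∷ (- (+ quotient d) , + 0)
      ∷ (⟦ c ⟧ , + 1) ∷ (- ⟦ c ⟧ , - (+ 1)) ∷ [] )
proposition2p2 m l h 0<m 0<l τ d (0<τ , gcd[h,q]≡1 , _) c τc≡-h =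
  Γ≅Cayley.Γ≅Cay m l h τ (quotient d)
    {{>-nonZero 0<m}} {{>-nonZero 0<τ}} {{quotient≢0 d {{>-nonZero 0<l}}}}
    (_∣_.equality d) (sym (gcd≡1⇒coprime gcd[h,q]≡1)) ⟦ c ⟧ (Congr⇒≡mod τc≡-h)
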